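{- For any sufficiently large integer $k$, consider a random bipartite graph $G=(L\sqcup R,E)$ where $L=R=\{1,2,\dots,k\}$ (as two disjoint copies) and $E$ consists of $k$ edges chosen uniformly at random without repetition from the set $L\times R\setminus\{(i,i):i\in[k]\}$. With probability at least $1-1/k^2$, there exists a matching in $G$ of size at least $0.1k$. -}

module Defs where

open import Data.Nat using (ℕ; zero; suc; _+_; _*_; _≤_)
open import Data.Bool using (Bool; true; false)
open import Data.Fin using (Fin)
open import Data.Vec using (Vec; []; _∷_; lookup)
open import Data.Product using (Σ; ∃; _×_)
open import Function.Definitions using (Injective)
open import Relation.Binary.PropositionalEquality using (_≡_)

-- A bipartite graph on L = R = {1..k} (two disjoint copies, indexed by Fin k),
-- given by its biadjacency matrix: row i, column j is true iff (i,j) ∈ E.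
-- Vectors (not functions) so that equality of graphs is canonical.
Graph : ℕ → Set
Graph k = Vec (Vec Bool k) k

Edge : ∀ {k} → Graph k → Fin k → Fin k → Set
Edge G i j = lookup (lookup G i) j ≡ true

trues : ∀ {n} → Vec Bool n → ℕ
trues [] = 0
trues (true ∷ v) = suc (trues v)
trues (false ∷ v) = trues v

edgeCount : ∀ {k m} → Vec (Vec Bool k) m → ℕ
edgeCount [] = 0
edgeCount (r ∷ rs) = trues r + edgeCount rs

-- An outcome of the random experiment: a set of exactly k edges from
-- L × R \ {(i,i)}.
Valid : ∀ k → Graph k → Set
Valid k G = ((i : Fin k) → lookup (lookup G i) i ≡ false) × edgeCount G ≡ k

MatchingOfSize : ∀ {k} → Graph k → ℕ → Set
MatchingOfSize {k} G m =
  Σ (Fin m → Fin k) λ f → Σ (Fin m → Fin k) λ g →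
    Injective _≡_ _≡_ f × Injective _≡_ _≡_ g × ((t : Fin m) → Edge G (f t) (g t))

HasLargeMatching : ∀ {k} → Graph k → Set
HasLargeMatching {k} G = ∃ λ m → k ≤ 10 * m × MatchingOfSize G m

module Submission where

-- A maximal matching, built greedily row by row, has some size s and its 2s endpoints form
-- a vertex cover (A, B). So if G has no matching of size k/10, its k edges lie among the
-- at most (|A| + |B|) k ≤ (k² − k)/5 cells covered by some pair (A, B) with
-- 5 (|A| + |B|) < k. Summing over the 4^k pairs and using C(p, k) 5^k ≤ C(5p, k), there
-- are at most 4^k C(k² − k, k) / 5^k such graphs, which is at most C(k² − k, k) / k²
-- because k² 4^k ≤ 5^k for k ≥ 40.

open import Defs
open import Algebra.Properties.CommutativeSemigroup using (x∙yz≈y∙xz)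
open import Data.Bool using (Bool; true; false; _∨_; f≤t; b≤b)
import Data.Bool as Bool
import Data.Bool.Properties as Boolₚ
open import Data.Empty using (⊥-elim)
open import Data.Fin using (Fin; zero; suc)
open import Data.Fin.Properties using (any?; suc-injective; injective⇒≤)
open import Data.List using (List; []; _∷_; [_]; _++_; map; concatMap; length)
import Data.List as List
open import Data.List.Properties using (length-map; length-++)
open import Data.List.Membership.Propositional using (_∈_; lose)
open import Data.List.Membership.Propositional.Properties
  using (∈-map⁺; ∈-++⁺ˡ; ∈-++⁺ʳ; ∈-concatMap⁺; ∈-lookup)
open import Data.List.Membership.Setoid.Properties using (index-injective)
open import Data.List.Relation.Unary.All using (All)
import Data.List.Relation.Unary.All as All
open import Data.List.Relation.Unary.AllPairs using ([]; _∷_)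
open import Data.List.Relation.Unary.Any using (here; index)
open import Data.List.Relation.Unary.Unique.Propositional using (Unique)
open import Data.Nat using (ℕ; zero; suc; _+_; _*_; _∸_; _^_; _≤_; _<_; z≤n; _<?_)
open import Data.Nat.Combinatorics using (_C_; nCk+nC[k+1]≡[n+1]C[k+1]; nC1≡n)
open import Data.Nat.Properties
  using ( ≤-refl; ≤-reflexive; ≤-trans; ≤-pred; ≤ᵇ⇒≤; ≰⇒>; n≤1+n; m≤m+n; m≤n+m
        ; m≤n⇒∃[o]m+o≡n; m≤n⇒m<n∨m≡n; suc[m]≤n⇒m≤pred[n]
        ; +-identityʳ; +-assoc; +-commutativeSemigroup; +-mono-≤; +-monoʳ-≤
        ; *-identityˡ; *-identityʳ; *-zeroʳ; *-comm; *-assoc; *-distribʳ-+; *-distribʳ-∸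
        ; *-mono-≤; *-monoˡ-≤; *-monoʳ-≤; *-cancelˡ-≤; m^n≢0
        ; module ≤-Reasoning )
open import Data.Nat.Tactic.RingSolver using (solve-∀)
open import Data.Product using (∃; ∃₂; _×_; _,_)
open import Data.Sum using (_⊎_; inj₁; inj₂)
import Data.Sum as Sum
open import Data.Vec using (Vec; []; _∷_; lookup; replicate; _[_]≔_; concat)
import Data.Vec as Vec
open import Data.Vec.Functional using () renaming (_∷_ to _∷ᶠ_)
open import Data.Vec.Properties using (lookup∘update; lookup-map; map-id)
open import Data.Vec.Relation.Binary.Pointwise.Extensional using (ext; extensional⇒inductive)
open import Data.Vec.Relation.Binary.Pointwise.Inductive
  using (Pointwise; []; _∷_; concat⁺; concat⁻; Pointwise-≡⇒≡; ≡⇒Pointwise-≡)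
import Data.Vec.Relation.Binary.Pointwise.Inductive as Pointwise
open import Function using (_∘_; id)
open import Function.Definitions using (Injective)
open import Relation.Binary.PropositionalEquality
  using (_≡_; _≢_; refl; sym; trans; cong; cong₂; subst; setoid; module ≡-Reasoning)
open import Relation.Nullary using (¬_; yes; no)
open import Relation.Nullary.Decidable using (_×-dec_)

[k+1]*[n+1]C[k+1]≡[n+1]*nCk : ∀ n k → suc k * (suc n C suc k) ≡ suc n * (n C k)
[k+1]*[n+1]C[k+1]≡[n+1]*nCk n       zero    =
  trans (+-identityʳ (suc n C 1)) (trans (nC1≡n (suc n)) (sym (*-identityʳ (suc n))))
[k+1]*[n+1]C[k+1]≡[n+1]*nCk zero    (suc k) = *-zeroʳ (2 + k)
[k+1]*[n+1]C[k+1]≡[n+1]*nCk (suc m) (suc k) = begin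
  (2 + k) * ((2 + m) C (2 + k))        ≡⟨ cong ((2 + k) *_) (nCk+nC[k+1]≡[n+1]C[k+1] (suc m) (suc k)) ⟨
  (2 + k) * (X + Y)                    ≡⟨ split k X Y ⟩
  (1 + k) * X + X + (2 + k) * Y        ≡⟨ cong₂ (λ a b → a + X + b) ([k+1]*[n+1]C[k+1]≡[n+1]*nCk m k)
                                                                  ([k+1]*[n+1]C[k+1]≡[n+1]*nCk m (suc k)) ⟩
  (1 + m) * u + X + (1 + m) * v        ≡⟨ cong (λ a → (1 + m) * u + a + (1 + m) * v) (nCk+nC[k+1]≡[n+1]C[k+1] m k) ⟨
  (1 + m) * u + (u + v) + (1 + m) * v  ≡⟨ merge m u v ⟩
  (2 + m) * (u + v)                    ≡⟨ cong ((2 + m) *_) (nCk+nC[k+1]≡[n+1]C[k+1] m k) ⟩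
  (2 + m) * X                          ∎
  where
  open ≡-Reasoning
  X Y u v : ℕ
  X = suc m C suc k
  Y = suc m C suc (suc k)
  u = m C k
  v = m C suc k
  split : ∀ a x y → (2 + a) * (x + y) ≡ (1 + a) * x + x + (2 + a) * y
  split = solve-∀
  merge : ∀ a x y → (1 + a) * x + (x + y) + (1 + a) * y ≡ (2 + a) * (x + y)
  merge = solve-∀

c*n≤m⇒nCk*c^k≤mCk : ∀ c k {n m} → c * n ≤ m → (n C k) * c ^ k ≤ m C k
c*n≤m⇒nCk*c^k≤mCk c       zero    _ = ≤-refl
c*n≤m⇒nCk*c^k≤mCk zero    (suc k) {n} _ = ≤-trans (≤-reflexive (*-zeroʳ (n C suc k))) z≤n
c*n≤m⇒nCk*c^k≤mCk (suc c) (suc k) {zero} _ = z≤n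
c*n≤m⇒nCk*c^k≤mCk (suc c) (suc k) {suc n} {suc m} c[1+n]≤1+m = *-cancelˡ-≤ (suc k) (begin
  suc k * ((suc n C suc k) * (suc c * c^k))  ≡⟨ regroup (suc k) (suc n C suc k) (suc c) c^k ⟩
  suc k * (suc n C suc k) * suc c * c^k      ≡⟨ cong (λ x → x * suc c * c^k) ([k+1]*[n+1]C[k+1]≡[n+1]*nCk n k) ⟩
  suc n * (n C k) * suc c * c^k              ≡⟨ regroup′ (suc n) (n C k) (suc c) c^k ⟩
  (suc c * suc n) * ((n C k) * c^k)          ≤⟨ *-mono-≤ c[1+n]≤1+m (c*n≤m⇒nCk*c^k≤mCk (suc c) k c*n≤m) ⟩
  suc m * (m C k)                            ≡⟨ [k+1]*[n+1]C[k+1]≡[n+1]*nCk m k ⟨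
  suc k * (suc m C suc k)                    ∎)
  where
  open ≤-Reasoning
  c^k : ℕ
  c^k = suc c ^ k
  c*n≤m : suc c * n ≤ m
  c*n≤m = ≤-trans (+-monoʳ-≤ n (*-monoʳ-≤ c (n≤1+n n))) (≤-pred c[1+n]≤1+m)
  regroup : ∀ a b c d → a * (b * (c * d)) ≡ a * b * c * d
  regroup = solve-∀
  regroup′ : ∀ a b c d → a * b * c * d ≡ (c * a) * (b * d)
  regroup′ = solve-∀

4*[1+k]²≤5*k² : ∀ {k} → 9 ≤ k → 4 * ((1 + k) * (1 + k)) ≤ 5 * (k * k)
4*[1+k]²≤5*k² 9≤k with d , refl ← m≤n⇒∃[o]m+o≡n 9≤k = begin
  4 * ((10 + d) * (10 + d))                         ≤⟨ m≤m+n _ (5 + 10 * d + d * d) ⟩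
  4 * ((10 + d) * (10 + d)) + (5 + 10 * d + d * d)  ≡⟨ expand d ⟩
  5 * ((9 + d) * (9 + d))                           ∎
  where
  open ≤-Reasoning
  expand : ∀ d → 4 * ((10 + d) * (10 + d)) + (5 + 10 * d + d * d) ≡ 5 * ((9 + d) * (9 + d))
  expand = solve-∀

k²*4^k≤5^k : ∀ {k} → 40 ≤ k → k * k * (2 ^ k * 2 ^ k) ≤ 5 ^ k
k²*4^k≤5^k {suc k} 40≤1+k with m≤n⇒m<n∨m≡n 40≤1+k
... | inj₂ refl   = ≤ᵇ⇒≤ _ _ _
... | inj₁ 40<1+k = begin
  (1 + k) * (1 + k) * ((2 * b) * (2 * b))  ≡⟨ regroup ((1 + k) * (1 + k)) b ⟩
  4 * ((1 + k) * (1 + k)) * (b * b)        ≤⟨ *-monoˡ-≤ (b * b) (4*[1+k]²≤5*k² (≤-trans (≤ᵇ⇒≤ 9 40 _) 40≤k)) ⟩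
  5 * (k * k) * (b * b)                    ≡⟨ *-assoc 5 (k * k) (b * b) ⟩
  5 * (k * k * (b * b))                    ≤⟨ *-monoʳ-≤ 5 (k²*4^k≤5^k 40≤k) ⟩
  5 * 5 ^ k                                ∎
  where
  open ≤-Reasoning
  40≤k : 40 ≤ k
  40≤k = ≤-pred 40<1+k
  b : ℕ
  b = 2 ^ k
  regroup : ∀ a b → a * ((2 * b) * (2 * b)) ≡ 4 * a * (b * b)
  regroup = solve-∀

trues-replicate-false : ∀ n → trues (replicate n false) ≡ 0
trues-replicate-false zero    = refl
trues-replicate-false (suc n) = trues-replicate-false n

trues-[]≔true : ∀ {n} (v : Vec Bool n) i → lookup v i ≡ false → trues (v [ i ]≔ true) ≡ suc (trues v)
trues-[]≔true (false ∷ v) zero    _      = refl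
trues-[]≔true (true  ∷ v) (suc i) vᵢ≡false = cong suc (trues-[]≔true v i vᵢ≡false)
trues-[]≔true (false ∷ v) (suc i) vᵢ≡false = trues-[]≔true v i vᵢ≡false

[]≔true-mono : ∀ {n} (v : Vec Bool n) i {j} → lookup v j ≡ true → lookup (v [ i ]≔ true) j ≡ true
[]≔true-mono (_ ∷ v) zero    {zero}  _  = refl
[]≔true-mono (_ ∷ v) zero    {suc j} vⱼ = vⱼ
[]≔true-mono (_ ∷ v) (suc i) {zero}  vⱼ = vⱼ
[]≔true-mono (_ ∷ v) (suc i) {suc j} vⱼ = []≔true-mono v i vⱼ

trues-++ : ∀ {m n} (u : Vec Bool m) (v : Vec Bool n) → trues (u Vec.++ v) ≡ trues u + trues v
trues-++ []          v = refl
trues-++ (true  ∷ u) v = cong suc (trues-++ u v)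
trues-++ (false ∷ u) v = trues-++ u v

trues-concat : ∀ {m n} (G : Vec (Vec Bool n) m) → trues (concat G) ≡ edgeCount G
trues-concat []      = refl
trues-concat (r ∷ G) = trans (trues-++ r (concat G)) (cong (trues r +_) (trues-concat G))

concat-injective : ∀ {A : Set} {m n} (xss yss : Vec (Vec A m) n) → concat xss ≡ concat yss → xss ≡ yss
concat-injective xss yss eq =
  Pointwise-≡⇒≡ (Pointwise.map Pointwise-≡⇒≡ (concat⁻ xss yss (≡⇒Pointwise-≡ eq)))

branch : ∀ {n} → List (Vec Bool n) → List (Vec Bool n) → List (Vec Bool (suc n))
branch xs ys = map (true ∷_) xs ++ map (false ∷_) ys

length-branch : ∀ {n} (xs ys : List (Vec Bool n)) → length (branch xs ys) ≡ length xs + length ys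
length-branch xs ys =
  trans (length-++ (map (true ∷_) xs)) (cong₂ _+_ (length-map (true ∷_) xs) (length-map (false ∷_) ys))

true∷-∈-branch : ∀ {n} {v : Vec Bool n} {xs} ys → v ∈ xs → (true ∷ v) ∈ branch xs ys
true∷-∈-branch ys v∈xs = ∈-++⁺ˡ (∈-map⁺ (true ∷_) v∈xs)

false∷-∈-branch : ∀ {n} {v : Vec Bool n} xs {ys} → v ∈ ys → (false ∷ v) ∈ branch xs ys
false∷-∈-branch xs v∈ys = ∈-++⁺ʳ (map (true ∷_) xs) (∈-map⁺ (false ∷_) v∈ys)

booleanVectors : ∀ n → List (Vec Bool n)
booleanVectors zero    = [ [] ]
booleanVectors (suc n) = branch (booleanVectors n) (booleanVectors n)

length-booleanVectors : ∀ n → length (booleanVectors n) ≡ 2 ^ n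
length-booleanVectors zero    = refl
length-booleanVectors (suc n) = begin
  length (branch (booleanVectors n) (booleanVectors n))  ≡⟨ length-branch (booleanVectors n) (booleanVectors n) ⟩
  length (booleanVectors n) + length (booleanVectors n)  ≡⟨ cong (λ l → l + l) (length-booleanVectors n) ⟩
  2 ^ n + 2 ^ n                                          ≡⟨ cong (2 ^ n +_) (+-identityʳ (2 ^ n)) ⟨
  2 * 2 ^ n                                              ∎
  where open ≡-Reasoning

∈-booleanVectors : ∀ {n} (v : Vec Bool n) → v ∈ booleanVectors n
∈-booleanVectors []                  = here refl
∈-booleanVectors         (true  ∷ v) = true∷-∈-branch _ (∈-booleanVectors v)
∈-booleanVectors {suc n} (false ∷ v) = false∷-∈-branch (booleanVectors n) (∈-booleanVectors v)

subsetsOfSize : ∀ {n} → Vec Bool n → ℕ → List (Vec Bool n)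
subsetsOfSize []          zero    = [ [] ]
subsetsOfSize []          (suc e) = []
subsetsOfSize (false ∷ M) e       = branch [] (subsetsOfSize M e)
subsetsOfSize (true  ∷ M) zero    = branch [] (subsetsOfSize M zero)
subsetsOfSize (true  ∷ M) (suc e) = branch (subsetsOfSize M e) (subsetsOfSize M (suc e))

length-subsetsOfSize : ∀ {n} (M : Vec Bool n) e → length (subsetsOfSize M e) ≡ trues M C e
length-subsetsOfSize []          zero    = refl
length-subsetsOfSize []          (suc e) = refl
length-subsetsOfSize (false ∷ M) e       =
  trans (length-branch [] (subsetsOfSize M e)) (length-subsetsOfSize M e)
length-subsetsOfSize (true  ∷ M) zero    =
  trans (length-branch [] (subsetsOfSize M zero)) (length-subsetsOfSize M zero)
length-subsetsOfSize (true  ∷ M) (suc e) = begin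
  length (branch (subsetsOfSize M e) (subsetsOfSize M (suc e)))
    ≡⟨ length-branch (subsetsOfSize M e) (subsetsOfSize M (suc e)) ⟩
  length (subsetsOfSize M e) + length (subsetsOfSize M (suc e))
    ≡⟨ cong₂ _+_ (length-subsetsOfSize M e) (length-subsetsOfSize M (suc e)) ⟩
  trues M C e + trues M C suc e
    ≡⟨ nCk+nC[k+1]≡[n+1]C[k+1] (trues M) e ⟩
  suc (trues M) C suc e
    ∎
  where open ≡-Reasoning

false∷-∈-subsetsOfSize : ∀ {n} {v : Vec Bool n} x M e →
                         v ∈ subsetsOfSize M e → (false ∷ v) ∈ subsetsOfSize (x ∷ M) e
false∷-∈-subsetsOfSize false M e       = false∷-∈-branch []
false∷-∈-subsetsOfSize true  M zero    = false∷-∈-branch []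
false∷-∈-subsetsOfSize true  M (suc e) = false∷-∈-branch (subsetsOfSize M e)

∈-subsetsOfSize : ∀ {n} {v M : Vec Bool n} → Pointwise Bool._≤_ v M → v ∈ subsetsOfSize M (trues v)
∈-subsetsOfSize []                              = here refl
∈-subsetsOfSize {M = _ ∷ M} (f≤t ∷ v≤M)         = false∷-∈-subsetsOfSize true  M _ (∈-subsetsOfSize v≤M)
∈-subsetsOfSize {M = _ ∷ M} (b≤b {false} ∷ v≤M) = false∷-∈-subsetsOfSize false M _ (∈-subsetsOfSize v≤M)
∈-subsetsOfSize             (b≤b {true}  ∷ v≤M) = true∷-∈-branch _ (∈-subsetsOfSize v≤M)

length-concatMap-≤ : ∀ {A B : Set} (f : A → List B) {a b} xs →
                     (∀ x → length (f x) * a ≤ b) → length (concatMap f xs) * a ≤ length xs * b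
length-concatMap-≤ f         []       _   = z≤n
length-concatMap-≤ f {a} {b} (x ∷ xs) f≤b = begin
  length (f x ++ concatMap f xs) * a               ≡⟨ cong (_* a) (length-++ (f x)) ⟩
  (length (f x) + length (concatMap f xs)) * a     ≡⟨ *-distribʳ-+ a (length (f x)) _ ⟩
  length (f x) * a + length (concatMap f xs) * a   ≤⟨ +-mono-≤ (f≤b x) (length-concatMap-≤ f xs f≤b) ⟩
  b + length xs * b                                ∎
  where open ≤-Reasoning

Unique⇒lookup-injective : ∀ {A : Set} {xs : List A} → Unique xs → Injective _≡_ _≡_ (List.lookup xs)
Unique⇒lookup-injective (x∉xs ∷ _)      {zero}  {zero}  _  = refl
Unique⇒lookup-injective (x∉xs ∷ _)      {zero}  {suc j} eq = ⊥-elim (All.lookup x∉xs (∈-lookup j) eq)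
Unique⇒lookup-injective (x∉xs ∷ _)      {suc i} {zero}  eq = ⊥-elim (All.lookup x∉xs (∈-lookup i) (sym eq))
Unique⇒lookup-injective (_    ∷ unique) {suc i} {suc j} eq = cong suc (Unique⇒lookup-injective unique eq)

length-≤-of-injection : ∀ {A B : Set} {f : A → B} {xs ys} → Injective _≡_ _≡_ f → Unique xs →
                        All (λ x → f x ∈ ys) xs → length xs ≤ length ys
length-≤-of-injection {f = f} {xs} {ys} f-injective unique f∈ys = injective⇒≤ position-injective
  where
  f[xs]∈ys : ∀ i → f (List.lookup xs i) ∈ ys
  f[xs]∈ys i = All.lookup f∈ys (∈-lookup i)
  position : Fin (length xs) → Fin (length ys)
  position i = index (f[xs]∈ys i)
  position-injective : Injective _≡_ _≡_ position
  position-injective {i} {j} eq =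
    Unique⇒lookup-injective unique (f-injective (index-injective (setoid _) (f[xs]∈ys i) (f[xs]∈ys j) eq))

∷ᶠ-injective : ∀ {A : Set} {s} {x : A} {f : Fin s → A} →
               (∀ t → f t ≢ x) → Injective _≡_ _≡_ f → Injective _≡_ _≡_ (x ∷ᶠ f)
∷ᶠ-injective x∉f f-injective {zero}  {zero}  _  = refl
∷ᶠ-injective x∉f f-injective {zero}  {suc u} eq = ⊥-elim (x∉f u (sym eq))
∷ᶠ-injective x∉f f-injective {suc t} {zero}  eq = ⊥-elim (x∉f t eq)
∷ᶠ-injective x∉f f-injective {suc t} {suc u} eq = cong suc (f-injective eq)

VertexCover : ∀ {m n} → Vec (Vec Bool n) m → Vec Bool m → Vec Bool n → Set
VertexCover G A B = ∀ i j → lookup (lookup G i) j ≡ true → lookup A i ≡ true ⊎ lookup B j ≡ true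

record MatchingWithCover {m n} (G : Vec (Vec Bool n) m) : Set where
  field
    size            : ℕ
    left            : Fin size → Fin m
    right           : Fin size → Fin n
    left-injective  : Injective _≡_ _≡_ left
    right-injective : Injective _≡_ _≡_ right
    matched         : ∀ t → lookup (lookup G (left t)) (right t) ≡ true
    coverˡ          : Vec Bool m
    coverʳ          : Vec Bool n
    ∣coverˡ∣≡size   : trues coverˡ ≡ size
    ∣coverʳ∣≡size   : trues coverʳ ≡ size
    right∈coverʳ    : ∀ t → lookup coverʳ (right t) ≡ true
    covers          : VertexCover G coverˡ coverʳ

emptyMatching : ∀ {n} → MatchingWithCover {n = n} []
emptyMatching {n} = record
  { size = 0 ; left = λ () ; right = λ () ; left-injective = λ {} ; right-injective = λ {}
  ; matched = λ () ; coverˡ = [] ; coverʳ = replicate n false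
  ; ∣coverˡ∣≡size = refl ; ∣coverʳ∣≡size = trues-replicate-false n
  ; right∈coverʳ = λ () ; covers = λ () }

module _ {m n} {r : Vec Bool n} {G : Vec (Vec Bool n) m} (M : MatchingWithCover G) where
  open MatchingWithCover M

  skipRow : (∀ j → lookup r j ≡ true → lookup coverʳ j ≡ true) → MatchingWithCover (r ∷ G)
  skipRow r⊆coverʳ = record
    { size = size ; left = suc ∘ left ; right = right
    ; left-injective = left-injective ∘ suc-injective ; right-injective = right-injective
    ; matched = matched ; coverˡ = false ∷ coverˡ ; coverʳ = coverʳ
    ; ∣coverˡ∣≡size = ∣coverˡ∣≡size ; ∣coverʳ∣≡size = ∣coverʳ∣≡size ; right∈coverʳ = right∈coverʳ
    ; covers = λ { zero j e → inj₂ (r⊆coverʳ j e) ; (suc i) j e → covers i j e } }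

  matchRow : ∀ j → lookup r j ≡ true → lookup coverʳ j ≡ false → MatchingWithCover (r ∷ G)
  matchRow j rⱼ≡true j∉coverʳ = record
    { size = suc size ; left = zero ∷ᶠ (suc ∘ left) ; right = j ∷ᶠ right
    ; left-injective = ∷ᶠ-injective (λ _ ()) (left-injective ∘ suc-injective)
    ; right-injective = ∷ᶠ-injective right≢j right-injective
    ; matched = λ { zero → rⱼ≡true ; (suc t) → matched t }
    ; coverˡ = true ∷ coverˡ ; coverʳ = coverʳ [ j ]≔ true
    ; ∣coverˡ∣≡size = cong suc ∣coverˡ∣≡size
    ; ∣coverʳ∣≡size = trans (trues-[]≔true coverʳ j j∉coverʳ) (cong suc ∣coverʳ∣≡size)
    ; right∈coverʳ = λ { zero    → lookup∘update j coverʳ true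
                       ; (suc t) → []≔true-mono coverʳ j (right∈coverʳ t) }
    ; covers = λ { zero _ _ → inj₁ refl ; (suc i) j′ e → Sum.map₂ ([]≔true-mono coverʳ j) (covers i j′ e) } }
    where
    right≢j : ∀ t → right t ≢ j
    right≢j t refl with () ← trans (sym (right∈coverʳ t)) j∉coverʳ

maximalMatching : ∀ {m n} (G : Vec (Vec Bool n) m) → MatchingWithCover G
maximalMatching []      = emptyMatching
maximalMatching (r ∷ G) with M ← maximalMatching G
  with any? (λ j → (lookup r j Boolₚ.≟ true) ×-dec (lookup (MatchingWithCover.coverʳ M) j Boolₚ.≟ false))
... | yes (j , rⱼ≡true , j∉coverʳ) = matchRow M j rⱼ≡true j∉coverʳ
... | no  noFreeNeighbour          =
  skipRow M λ j rⱼ≡true → Boolₚ.¬-not λ j∉coverʳ → noFreeNeighbour (j , rⱼ≡true , j∉coverʳ)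

noLargeMatching⇒smallVertexCover : ∀ {k} (G : Graph k) → ¬ HasLargeMatching G →
                                   ∃₂ λ A B → 5 * (trues A + trues B) < k × VertexCover G A B
noLargeMatching⇒smallVertexCover {k} G noLargeMatching = coverˡ , coverʳ , 5∣cover∣<k , covers
  where
  open MatchingWithCover (maximalMatching G)
  open ≤-Reasoning
  k≰10*size : ¬ k ≤ 10 * size
  k≰10*size k≤10*size =
    noLargeMatching (size , k≤10*size , left , right , left-injective , right-injective , matched)
  5*[s+s]≡10*s : ∀ s → 5 * (s + s) ≡ 10 * s
  5*[s+s]≡10*s = solve-∀
  5∣cover∣<k : 5 * (trues coverˡ + trues coverʳ) < k
  5∣cover∣<k = begin-strict
    5 * (trues coverˡ + trues coverʳ)  ≡⟨ cong₂ (λ a b → 5 * (a + b)) ∣coverˡ∣≡size ∣coverʳ∣≡size ⟩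
    5 * (size + size)                  ≡⟨ 5*[s+s]≡10*s size ⟩
    10 * size                          <⟨ ≰⇒> {k} {10 * size} k≰10*size ⟩
    k                                  ∎

≤-∨⁺ : ∀ {x a b} → (x ≡ true → a ≡ true ⊎ b ≡ true) → x Bool.≤ a ∨ b
≤-∨⁺ {false}        _ = Boolₚ.≤-minimum _
≤-∨⁺ {true} {true}  _ = b≤b
≤-∨⁺ {true} {false} x⇒a∨b with inj₂ refl ← x⇒a∨b refl = b≤b

coveredCells : ∀ {m n} → Vec Bool m → Vec Bool n → Vec (Vec Bool n) m
coveredCells A B = Vec.map (λ a → Vec.map (a ∨_) B) A

lookup-coveredCells : ∀ {m n} (A : Vec Bool m) (B : Vec Bool n) i j →
                      lookup (lookup (coveredCells A B) i) j ≡ lookup A i ∨ lookup B j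
lookup-coveredCells A B i j =
  trans (cong (λ row → lookup row j) (lookup-map i _ A)) (lookup-map j _ B)

VertexCover⇒⊆coveredCells : ∀ {m n} (G : Vec (Vec Bool n) m) {A B} →
                            VertexCover G A B → Pointwise (Pointwise Bool._≤_) G (coveredCells A B)
VertexCover⇒⊆coveredCells G {A} {B} cover =
  extensional⇒inductive (ext λ i → extensional⇒inductive (ext λ j →
    subst (lookup (lookup G i) j Bool.≤_) (sym (lookup-coveredCells A B i j)) (≤-∨⁺ (cover i j))))

trues-map-true∨ : ∀ {n} (v : Vec Bool n) → trues (Vec.map (true ∨_) v) ≡ n
trues-map-true∨ []      = refl
trues-map-true∨ (_ ∷ v) = cong suc (trues-map-true∨ v)

edgeCount-coveredCells : ∀ {m n} (A : Vec Bool m) (B : Vec Bool n) →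
                         edgeCount (coveredCells A B) ≤ trues A * n + m * trues B
edgeCount-coveredCells []          B = z≤n
edgeCount-coveredCells {suc m} {n} (true ∷ A) B = begin
  trues (Vec.map (true ∨_) B) + rest         ≡⟨ cong (_+ rest) (trues-map-true∨ B) ⟩
  n + rest                                   ≤⟨ +-monoʳ-≤ n (edgeCount-coveredCells A B) ⟩
  n + (trues A * n + m * trues B)            ≡⟨ +-assoc n (trues A * n) (m * trues B) ⟨
  n + trues A * n + m * trues B              ≤⟨ +-monoʳ-≤ (n + trues A * n) (m≤n+m (m * trues B) (trues B)) ⟩
  n + trues A * n + (trues B + m * trues B)  ∎
  where
  open ≤-Reasoning
  rest : ℕ
  rest = edgeCount (coveredCells A B)
edgeCount-coveredCells {suc m} {n} (false ∷ A) B = begin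
  trues (Vec.map id B) + rest                ≡⟨ cong (λ row → trues row + rest) (map-id B) ⟩
  trues B + rest                             ≤⟨ +-monoʳ-≤ (trues B) (edgeCount-coveredCells A B) ⟩
  trues B + (trues A * n + m * trues B)      ≡⟨ x∙yz≈y∙xz +-commutativeSemigroup (trues B) (trues A * n) (m * trues B) ⟩
  trues A * n + (trues B + m * trues B)      ∎
  where
  open ≤-Reasoning
  rest : ℕ
  rest = edgeCount (coveredCells A B)

-- Graphs are counted through their flattenings concat G : Vec Bool (k * k), as k-subsets of the
-- cells covered by a small pair (A, B).
candidates : ∀ k → Vec Bool k → Vec Bool k → List (Vec Bool (k * k))
candidates k A B with 5 * (trues A + trues B) <? k
... | yes _ = subsetsOfSize (concat (coveredCells A B)) k
... | no  _ = []

length-candidates : ∀ k A B → length (candidates k A B) * 5 ^ k ≤ (k * k ∸ k) C k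
length-candidates k A B with 5 * (trues A + trues B) <? k
... | no  _     = z≤n
... | yes small = begin
  length (subsetsOfSize cells k) * 5 ^ k  ≡⟨ cong (_* 5 ^ k) (length-subsetsOfSize cells k) ⟩
  (trues cells C k) * 5 ^ k               ≤⟨ c*n≤m⇒nCk*c^k≤mCk 5 k 5*∣cells∣≤k*k∸k ⟩
  (k * k ∸ k) C k                         ∎
  where
  open ≤-Reasoning
  cells : Vec Bool (k * k)
  cells = concat (coveredCells A B)
  5*∣cells∣≤k*k∸k : 5 * trues cells ≤ k * k ∸ k
  5*∣cells∣≤k*k∸k = begin
    5 * trues cells                   ≡⟨ cong (5 *_) (trues-concat (coveredCells A B)) ⟩
    5 * edgeCount (coveredCells A B)  ≤⟨ *-monoʳ-≤ 5 (edgeCount-coveredCells A B) ⟩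
    5 * (trues A * k + k * trues B)   ≡⟨ cong (λ x → 5 * (trues A * k + x)) (*-comm k (trues B)) ⟩
    5 * (trues A * k + trues B * k)   ≡⟨ cong (5 *_) (*-distribʳ-+ k (trues A) (trues B)) ⟨
    5 * ((trues A + trues B) * k)     ≡⟨ *-assoc 5 (trues A + trues B) k ⟨
    5 * (trues A + trues B) * k       ≤⟨ *-monoˡ-≤ k (suc[m]≤n⇒m≤pred[n] small) ⟩
    (k ∸ 1) * k                       ≡⟨ *-distribʳ-∸ k k 1 ⟩
    k * k ∸ 1 * k                     ≡⟨ cong (k * k ∸_) (*-identityˡ k) ⟩
    k * k ∸ k                         ∎

∈-candidates : ∀ {k} (G : Graph k) {A B} → 5 * (trues A + trues B) < k → VertexCover G A B →
               edgeCount G ≡ k → concat G ∈ candidates k A B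
∈-candidates {k} G {A} {B} small cover ∣G∣≡k with 5 * (trues A + trues B) <? k
... | no  large = ⊥-elim (large small)
... | yes _     = subst (λ e → concat G ∈ subsetsOfSize (concat (coveredCells A B)) e)
                        (trans (trues-concat G) ∣G∣≡k)
                        (∈-subsetsOfSize (concat⁺ (VertexCover⇒⊆coveredCells G {A} {B} cover)))

allCandidates : ∀ k → List (Vec Bool (k * k))
allCandidates k = concatMap (λ A → concatMap (candidates k A) (booleanVectors k)) (booleanVectors k)

length-allCandidates : ∀ k → length (allCandidates k) * 5 ^ k ≤ 2 ^ k * 2 ^ k * ((k * k ∸ k) C k)
length-allCandidates k = begin
  length (allCandidates k) * 5 ^ k
    ≤⟨ length-concatMap-≤ _ (booleanVectors k) (λ A →
         length-concatMap-≤ _ (booleanVectors k) (length-candidates k A)) ⟩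
  length (booleanVectors k) * (length (booleanVectors k) * ((k * k ∸ k) C k))
    ≡⟨ cong₂ (λ x y → x * (y * ((k * k ∸ k) C k))) (length-booleanVectors k) (length-booleanVectors k) ⟩
  2 ^ k * (2 ^ k * ((k * k ∸ k) C k))
    ≡⟨ *-assoc (2 ^ k) (2 ^ k) ((k * k ∸ k) C k) ⟨
  2 ^ k * 2 ^ k * ((k * k ∸ k) C k)
    ∎
  where open ≤-Reasoning

concat-∈-allCandidates : ∀ {k} (G : Graph k) → Valid k G → ¬ HasLargeMatching G → concat G ∈ allCandidates k
concat-∈-allCandidates G (_ , ∣G∣≡k) noLargeMatching
  with A , B , small , cover ← noLargeMatching⇒smallVertexCover G noLargeMatching =
  ∈-concatMap⁺ _ (lose (∈-booleanVectors A)
    (∈-concatMap⁺ _ (lose (∈-booleanVectors B) (∈-candidates G small cover ∣G∣≡k))))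

length-badGraphs : ∀ k (bad : List (Graph k)) → Unique bad →
                   All (λ G → Valid k G × ¬ HasLargeMatching G) bad →
                   length bad * 5 ^ k ≤ 2 ^ k * 2 ^ k * ((k * k ∸ k) C k)
length-badGraphs k bad unique allBad = begin
  length bad * 5 ^ k                 ≤⟨ *-monoˡ-≤ (5 ^ k) length-bad≤ ⟩
  length (allCandidates k) * 5 ^ k   ≤⟨ length-allCandidates k ⟩
  2 ^ k * 2 ^ k * ((k * k ∸ k) C k)  ∎
  where
  open ≤-Reasoning
  length-bad≤ : length bad ≤ length (allCandidates k)
  length-bad≤ = length-≤-of-injection (concat-injective _ _) unique
    (All.map (λ { {G} (valid , noLarge) → concat-∈-allCandidates G valid noLarge }) allBad)

proposition5p22 : ∃ λ K → (k : ℕ) → K ≤ k →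
    (bad : List (Graph k)) → Unique bad →
    All (λ G → Valid k G × ¬ HasLargeMatching G) bad →
    length bad * (k * k) ≤ (k * k ∸ k) C k
proposition5p22 = 40 , λ k 40≤k bad unique allBad → *-cancelˡ-≤ (5 ^ k) {{m^n≢0 5 k}} (begin
  5 ^ k * (length bad * (k * k))               ≡⟨ regroup (5 ^ k) (length bad) (k * k) ⟩
  length bad * 5 ^ k * (k * k)                 ≤⟨ *-monoˡ-≤ (k * k) (length-badGraphs k bad unique allBad) ⟩
  2 ^ k * 2 ^ k * ((k * k ∸ k) C k) * (k * k)  ≡⟨ regroup′ (2 ^ k * 2 ^ k) ((k * k ∸ k) C k) (k * k) ⟩
  k * k * (2 ^ k * 2 ^ k) * ((k * k ∸ k) C k)  ≤⟨ *-monoˡ-≤ ((k * k ∸ k) C k) (k²*4^k≤5^k 40≤k) ⟩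
  5 ^ k * ((k * k ∸ k) C k)                    ∎)
  where
  open ≤-Reasoning
  regroup : ∀ a b c → a * (b * c) ≡ b * a * c
  regroup = solve-∀
  regroup′ : ∀ a b c → a * b * c ≡ c * a * b
  regroup′ = solve-∀
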